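{- Let $X,Y$ be $R^+$-spaces and let $P\subseteq(R^+)^{|X|}$, $Q\subseteq(R^+)^{|Y|}$ be coverings such that $P^{\perp\perp}=P(X)$ and $Q^{\perp\perp}=P(Y)$. Then $P(X\otimes Y)=(P\otimes Q)^{\perp\perp}$.
   Context: PCM: a nonempty set with a partial sum $\Sigma$ on countably indexed families ("summable" families) satisfying (Unary) singletons $(x)$ are summable with sum $x$, and (WPA) for summable $(x_a)_{a\in A}$ and a countable partition $\{A_i\}_{i\in I}$ of $A$ (parts possibly empty), each $(x_a)_{a\in A_i}$ is summable and $(\sum_{a\in A_i}x_a)_i$ is summable with sum $\sum_{a\in A}x_a$; strong if also (PA): if each $(x_a)_{a\in A_i}$ and $(\sum_{a\in A_i}x_a)_i$ are summable then $(x_a)_{a\in A}$ is summable. $0$ is the empty sum; $x\le y$ iff $x+z=y$ for some $z$. A PCR $(R,\Sigma,1,\cdot)$ is a PCM with a commutative monoid $(R,1,\cdot)$ such that for summable $(x_a),(y_b)$, $(x_ay_b)_{(a,b)}$ is summable with sum $(\sum x_a)(\sum y_b)$; strong if its PCM is strong. Setting: $R^+$ a strong PCR, $\mathcal B\subseteq R^+$ downward closed. Webs are countable sets. $\langle x,y\rangle=\sum_a x_ay_a$ (partial); $x\perp y$ iff $\langle x,y\rangle$ is defined and in $\mathcal B$; $F^\perp=\{y\mid\forall x\in F, x\perp y\}$. A covering of $(R^+)^W$ is $F$ such that every $a\in W$ has some $x\in F$ with $x_a$ invertible. An $R^+$-space is $X=(|X|,P(X))$ with $P(X)\subseteq(R^+)^{|X|}$,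 $P(X)^{\perp\perp}=P(X)$, and $P(X)$, $P(X)^\perp$ coverings. $(x\otimes y)_{a,b}=x_ay_b$, $F\otimes G=\{x\otimes y\mid x\in F,y\in G\}$, and $X\otimes Y=(|X|\times|Y|,(P(X)\otimes P(Y))^{\perp\perp})$. -}

module Defs where

open import Level using (0ℓ)
open import Data.Nat using (ℕ)
open import Data.Bool using (Bool; true; false; if_then_else_)
open import Data.Unit using (⊤)
open import Data.Product using (Σ; Σ-syntax; _×_; _,_; proj₁; proj₂)
open import Function using (_∘_)
open import Relation.Binary.PropositionalEquality using (_≡_)

record Countable (A : Set) : Set where
  field
    enc     : A → ℕ
    enc-inj : ∀ a b → enc a ≡ enc b → a ≡ b

-- The partial sum Σ is represented by the relation  Sum A x s
-- ("(x_a)_{a∈A} is summable with sum s").  A partition {A_i}_{i∈I} of A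
-- (parts possibly empty) is given by a map  p : A → I ; its parts are
-- A_i = Σ A (λ a → p a ≡ i).

Part : {A I : Set} → (A → I) → I → Set
Part {A} p i = Σ A (λ a → p a ≡ i)

record PCM : Set₁ where
  field
    Carrier    : Set
    inhabitant : Carrier
    Sum        : (A : Set) → (A → Carrier) → Carrier → Set
    Sum-unique : ∀ {A x s t} → Sum A x s → Sum A x t → s ≡ t
    -- families are functions in the set-theoretic (extensional) sense
    Sum-cong   : ∀ {A} {x y : A → Carrier} {s} →
                 (∀ a → x a ≡ y a) → Sum A x s → Sum A y s
    unary      : ∀ (A : Set) (a₀ : A) → (∀ a → a ≡ a₀) →
                 (v : Carrier) → Sum A (λ _ → v) v
    wpa        : ∀ {A I : Set} → Countable A → Countable I →
                 (p : A → I) (x : A → Carrier) (s : Carrier) →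
                 Sum A x s →
                 Σ[ t ∈ (I → Carrier) ]
                   ((∀ i → Sum (Part p i) (x ∘ proj₁) (t i)) × Sum I t s)

  _+_≈_ : Carrier → Carrier → Carrier → Set
  x + z ≈ y = Sum Bool (λ b → if b then x else z) y

  _≤_ : Carrier → Carrier → Set
  x ≤ y = Σ[ z ∈ Carrier ] (x + z ≈ y)

record StrongPCM : Set₁ where
  field
    pcm : PCM
  open PCM pcm
  field
    pa : ∀ {A I : Set} → Countable A → Countable I →
         (p : A → I) (x : A → Carrier) (t : I → Carrier) (s : Carrier) →
         (∀ i → Sum (Part p i) (x ∘ proj₁) (t i)) → Sum I t s →
         Σ[ r ∈ Carrier ] Sum A x r

record StrongPCR : Set₁ where
  field
    spcm : StrongPCM
  open StrongPCM spcm public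
  open PCM pcm public
  field
    one     : Carrier
    _·_     : Carrier → Carrier → Carrier
    ·-assoc : ∀ x y z → (x · y) · z ≡ x · (y · z)
    ·-comm  : ∀ x y → x · y ≡ y · x
    ·-idˡ   : ∀ x → one · x ≡ x
    ·-sum   : ∀ {A B : Set} → Countable A → Countable B →
              (x : A → Carrier) (y : B → Carrier) (s t : Carrier) →
              Sum A x s → Sum B y t →
              Sum (A × B) (λ ab → x (proj₁ ab) · y (proj₂ ab)) (s · t)

  Invertible : Carrier → Set
  Invertible x = Σ[ y ∈ Carrier ] (x · y ≡ one)

module Orth (R : StrongPCR) (𝓑 : StrongPCR.Carrier R → Set) where
  open StrongPCR R

  DownClosed : Set
  DownClosed = ∀ x y → x ≤ y → 𝓑 y → 𝓑 x

  Subset : Set → Set₁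
  Subset W = (W → Carrier) → Set

  _⊆_ : {W : Set} → Subset W → Subset W → Set
  F ⊆ G = ∀ x → F x → G x

  _≐_ : {W : Set} → Subset W → Subset W → Set
  F ≐ G = (F ⊆ G) × (G ⊆ F)

  _⊥_ : {W : Set} → (W → Carrier) → (W → Carrier) → Set
  _⊥_ {W} x y = Σ[ s ∈ Carrier ] (Sum W (λ a → x a · y a) s × 𝓑 s)

  _^⊥ : {W : Set} → Subset W → Subset W
  (F ^⊥) y = ∀ x → F x → x ⊥ y

  Covering : {W : Set} → Subset W → Set
  Covering {W} F = ∀ a → Σ[ x ∈ (W → Carrier) ] (F x × Invertible (x a))

  _⊗ᵥ_ : {W V : Set} → (W → Carrier) → (V → Carrier) → (W × V → Carrier)
  (x ⊗ᵥ y) ab = x (proj₁ ab) · y (proj₂ ab)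

  _⊗ₛ_ : {W V : Set} → Subset W → Subset V → Subset (W × V)
  (F ⊗ₛ G) z = Σ[ x ∈ _ ] Σ[ y ∈ _ ] (F x × G y × (∀ ab → z ab ≡ (x ⊗ᵥ y) ab))

  record RSpace : Set₁ where
    field
      Web      : Set
      countable : Countable Web
      P        : Subset Web
      closed   : ((P ^⊥) ^⊥) ≐ P
      covP     : Covering P
      covP⊥    : Covering (P ^⊥)
  open RSpace public

  P⊗ : (X Y : RSpace) → Subset (Web X × Web Y)
  P⊗ X Y = ((P X ⊗ₛ P Y) ^⊥) ^⊥

-- Given z orthogonal to every x ⊗ y with x in a covering P, consider the partial
-- contraction c_a = Σ_b y_b z_{a,b}.  Each row sum exists: pick x ∈ P with x_a
-- invertible; the a-th row of ⟨x ⊗ y, z⟩ is x_a times it.  By Fubini (WPA and PA)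
-- ⟨x ⊗ y, z⟩ = ⟨x, c⟩ for every x, so c ∈ P^⊥, and hence x ⊗ y ⊥ z even for
-- x ∈ P^⊥⊥.  Doing this in both factors gives (P ⊗ Q)^⊥ ⊆ (P^⊥⊥ ⊗ Q^⊥⊥)^⊥, and
-- taking orthogonals again turns it into the claimed equality.
module Submission where

open import Defs
open import Level using (0ℓ)
open import Data.Nat using (ℕ; zero; suc; _+_; _<_; _≤_; z≤n; s≤s)
open import Data.Nat.Properties
  using (+-mono-≤; +-monoʳ-≤; +-comm; ≤-trans; ≤-reflexive; <-≤-trans; <-cmp; <-irrefl; m≤m+n; +-cancelˡ-≡)
open import Data.Product using (_×_; Σ-syntax; _,_; proj₁; proj₂; swap)
open import Data.Product.Algebra using (×-comm; ×-identityˡ)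
open import Data.Unit.Polymorphic using (⊤; tt)
open import Data.Empty using (⊥-elim)
open import Function using (_∘_)
open import Function.Bundles using (_↔_; Inverse; mk↔ₛ′; _⇔_; mk⇔; Equivalence)
open import Function.Properties.Inverse using (↔-sym)
open import Relation.Binary.Definitions using (tri<; tri≈; tri>)
open import Relation.Binary.PropositionalEquality using (_≡_; refl; sym; trans; cong; cong₂; subst; module ≡-Reasoning)

tri : ℕ → ℕ
tri zero    = zero
tri (suc d) = suc d + tri d

tri-mono-≤ : ∀ {d d′} → d ≤ d′ → tri d ≤ tri d′
tri-mono-≤ z≤n     = z≤n
tri-mono-≤ (s≤s p) = +-mono-≤ (s≤s p) (tri-mono-≤ p)

tri+m<tri : ∀ {m d d′} → m ≤ d → d < d′ → tri d + m < tri d′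
tri+m<tri {m} {d} m≤d d<d′ =
  <-≤-trans (s≤s (≤-trans (+-monoʳ-≤ (tri d) m≤d) (≤-reflexive (+-comm (tri d) d))))
            (tri-mono-≤ d<d′)

cantor : ℕ → ℕ → ℕ
cantor m n = tri (m + n) + m

cantor-injective : ∀ m n m′ n′ → cantor m n ≡ cantor m′ n′ → m ≡ m′ × n ≡ n′
cantor-injective m n m′ n′ eq with <-cmp (m + n) (m′ + n′)
... | tri< d<d′ _ _ = ⊥-elim (<-irrefl eq
        (<-≤-trans (tri+m<tri (m≤m+n m n) d<d′) (m≤m+n (tri (m′ + n′)) m′)))
... | tri> _ _ d′<d = ⊥-elim (<-irrefl (sym eq)
        (<-≤-trans (tri+m<tri (m≤m+n m′ n′) d′<d) (m≤m+n (tri (m + n)) m)))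
... | tri≈ _ d≡d′ _ = m≡m′ , +-cancelˡ-≡ m′ n n′ (subst (λ k → k + n ≡ m′ + n′) m≡m′ d≡d′)
  where
  m≡m′ : m ≡ m′
  m≡m′ = +-cancelˡ-≡ (tri (m′ + n′)) m m′ (subst (λ d → tri d + m ≡ cantor m′ n′) d≡d′ eq)

Countable-× : ∀ {A B : Set} → Countable A → Countable B → Countable (A × B)
Countable-× cA cB = record
  { enc     = λ (a , b) → cantor (enc cA a) (enc cB b)
  ; enc-inj = λ (a , b) (a′ , b′) eq →
      let (ea , eb) = cantor-injective _ _ _ _ eq
      in cong₂ _,_ (enc-inj cA a a′ ea) (enc-inj cB b b′ eb)
  }
  where open Countable

Countable-⊤ : Countable ⊤
Countable-⊤ = record { enc = λ _ → 0 ; enc-inj = λ _ _ _ → refl }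

Countable-↔ : ∀ {A B : Set} → Countable A → A ↔ B → Countable B
Countable-↔ cA e = record
  { enc     = enc cA ∘ from
  ; enc-inj = λ b b′ eq →
      trans (sym (strictlyInverseˡ b))
            (trans (cong to (enc-inj cA (from b) (from b′) eq)) (strictlyInverseˡ b′))
  }
  where
  open Countable
  open Inverse e

Part-≡ : ∀ {A I : Set} {p : A → I} {i : I} {u v : Part p i} → proj₁ u ≡ proj₁ v → u ≡ v
Part-≡ {u = a , refl} {v = .a , refl} refl = refl

Part-proj₁↔ : ∀ {W V : Set} (a : W) → Part {W × V} proj₁ a ↔ V
Part-proj₁↔ a = mk↔ₛ′ (proj₂ ∘ proj₁) (λ b → (a , b) , refl)
  (λ _ → refl) (λ { ((.a , _) , refl) → refl })

module PCMProperties (M : PCM) where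
  open PCM M

  Sum-reindex : ∀ {A B : Set} → Countable A → (e : A ↔ B) →
                ∀ {x : A → Carrier} {s} → Sum A x s → Sum B (x ∘ Inverse.from e) s
  Sum-reindex cA e {x} {s} S with wpa cA (Countable-↔ cA e) (Inverse.to e) x s S
  ... | t , parts , total = Sum-cong t≡x∘from total
    where
    open Inverse e

    fibre-unique : ∀ b (u : Part to b) → u ≡ (from b , strictlyInverseˡ b)
    fibre-unique b (a , refl) = Part-≡ (sym (strictlyInverseʳ a))

    t≡x∘from : ∀ b → t b ≡ x (from b)
    t≡x∘from b = Sum-unique (parts b)
      (Sum-cong (λ u → cong (x ∘ proj₁) (sym (fibre-unique b u)))
        (unary (Part to b) _ (fibre-unique b) (x (from b))))

  Sum-Part-proj₁⇔Sum-row : ∀ {W V : Set} → Countable V → {F : W × V → Carrier} (a : W) {s : Carrier} →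
                           Sum (Part proj₁ a) (F ∘ proj₁) s ⇔ Sum V (λ b → F (a , b)) s
  Sum-Part-proj₁⇔Sum-row cV a = mk⇔
    (Sum-reindex (Countable-↔ cV (↔-sym (Part-proj₁↔ a))) (Part-proj₁↔ a))
    (Sum-cong (λ { ((.a , _) , refl) → refl }) ∘ Sum-reindex cV (↔-sym (Part-proj₁↔ a)))

  Sum-rows : ∀ {W V : Set} → Countable W → Countable V → {F : W × V → Carrier} {s : Carrier} →
             Sum (W × V) F s →
             Σ[ t ∈ (W → Carrier) ] ((∀ a → Sum V (λ b → F (a , b)) (t a)) × Sum W t s)
  Sum-rows cW cV S with wpa (Countable-× cW cV) cW proj₁ _ _ S
  ... | t , parts , total = t , (λ a → Equivalence.to (Sum-Part-proj₁⇔Sum-row cV a) (parts a)) , total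

module StrongPCMProperties (S : StrongPCM) where
  open StrongPCM S
  open PCM pcm
  open PCMProperties pcm

  Sum-fromRows : ∀ {W V : Set} → Countable W → Countable V → {F : W × V → Carrier} {t : W → Carrier} {s : Carrier} →
                 (∀ a → Sum V (λ b → F (a , b)) (t a)) → Sum W t s → Sum (W × V) F s
  Sum-fromRows cW cV rows total
    with pa (Countable-× cW cV) cW proj₁ _ _ _ (λ a → Equivalence.from (Sum-Part-proj₁⇔Sum-row cV a) (rows a)) total
  ... | r , Sr with Sum-rows cW cV Sr
  ... | t′ , rows′ , total′ =
    subst (Sum _ _) (Sum-unique (Sum-cong (λ a → Sum-unique (rows′ a) (rows a)) total′) total) Sr

module StrongPCRProperties (R : StrongPCR) where
  open StrongPCR R
  open PCMProperties pcm

  Sum-scaleˡ : ∀ {B : Set} → Countable B → ∀ c {u : B → Carrier} {s} →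
               Sum B u s → Sum B (λ b → c · u b) (c · s)
  Sum-scaleˡ cB c S = Sum-reindex (Countable-× Countable-⊤ cB) (×-identityˡ 0ℓ _)
    (·-sum Countable-⊤ cB (λ _ → c) _ c _ (unary ⊤ tt (λ _ → refl) c) S)

  Sum-cancelˡ : ∀ {B : Set} → Countable B → ∀ {c} → Invertible c → {u : B → Carrier} {s : Carrier} →
                Sum B (λ b → c · u b) s → Σ[ r ∈ Carrier ] Sum B u r
  Sum-cancelˡ cB {c} (c⁻¹ , cc⁻¹≡1) {u} {s} S = c⁻¹ · s , Sum-cong c⁻¹[cu]≡u (Sum-scaleˡ cB c⁻¹ S)
    where
    open ≡-Reasoning
    c⁻¹[cu]≡u : ∀ b → c⁻¹ · (c · u b) ≡ u b
    c⁻¹[cu]≡u b = begin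
      c⁻¹ · (c · u b)  ≡⟨ sym (·-assoc c⁻¹ c (u b)) ⟩
      (c⁻¹ · c) · u b  ≡⟨ cong (_· u b) (trans (·-comm c⁻¹ c) cc⁻¹≡1) ⟩
      one · u b        ≡⟨ ·-idˡ (u b) ⟩
      u b              ∎

module OrthProperties (R : StrongPCR) (𝓑 : StrongPCR.Carrier R → Set) where
  open StrongPCR R
  open Orth R 𝓑
  open PCMProperties pcm
  open StrongPCMProperties spcm
  open StrongPCRProperties R

  ⊆-trans : ∀ {W : Set} {F G H : Subset W} → F ⊆ G → G ⊆ H → F ⊆ H
  ⊆-trans F⊆G G⊆H x = G⊆H x ∘ F⊆G x

  ^⊥-antitone : ∀ {W : Set} {F G : Subset W} → F ⊆ G → (G ^⊥) ⊆ (F ^⊥)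
  ^⊥-antitone F⊆G y y∈G^⊥ x x∈F = y∈G^⊥ x (F⊆G x x∈F)

  ⊥-comm : ∀ {W : Set} {x y : W → Carrier} → x ⊥ y → y ⊥ x
  ⊥-comm {x = x} {y} (s , S , s∈𝓑) = s , Sum-cong (λ a → ·-comm (x a) (y a)) S , s∈𝓑

  ⊆-^⊥^⊥ : ∀ {W : Set} (F : Subset W) → F ⊆ ((F ^⊥) ^⊥)
  ⊆-^⊥^⊥ F x x∈F y y∈F^⊥ = ⊥-comm (y∈F^⊥ x x∈F)

  ⊥-congˡ : ∀ {W : Set} {x x′ z : W → Carrier} → (∀ a → x a ≡ x′ a) → x ⊥ z → x′ ⊥ z
  ⊥-congˡ {z = z} x≗x′ (s , S , s∈𝓑) = s , Sum-cong (λ a → cong (_· z a) (x≗x′ a)) S , s∈𝓑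

  ⊗ₛ-mono : ∀ {W V : Set} {F F′ : Subset W} {G G′ : Subset V} →
            F ⊆ F′ → G ⊆ G′ → (F ⊗ₛ G) ⊆ (F′ ⊗ₛ G′)
  ⊗ₛ-mono F⊆F′ G⊆G′ _ (x , y , x∈F , y∈G , z≗x⊗y) = x , y , F⊆F′ x x∈F , G⊆G′ y y∈G , z≗x⊗y

  ⊗ᵥ-⊥-swap : ∀ {W V : Set} → Countable W → Countable V →
              {x : W → Carrier} {y : V → Carrier} {z : W × V → Carrier} →
              (x ⊗ᵥ y) ⊥ z → (y ⊗ᵥ x) ⊥ (z ∘ swap)
  ⊗ᵥ-⊥-swap {W} {V} cW cV {x} {y} {z} (s , S , s∈𝓑) =
    s , Sum-cong (λ (b , a) → cong (_· z (a , b)) (·-comm (x a) (y b)))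
                 (Sum-reindex (Countable-× cW cV) (×-comm W V) S) , s∈𝓑

  module _ {W V : Set} (cW : Countable W) (cV : Countable V) {y : V → Carrier} {z : W × V → Carrier} where

    ⊗ᵥ-⊥⇔⊥-contraction : {c : W → Carrier} → (∀ a → Sum V (λ b → y b · z (a , b)) (c a)) →
                         ∀ x → ((x ⊗ᵥ y) ⊥ z) ⇔ (x ⊥ c)
    ⊗ᵥ-⊥⇔⊥-contraction {c} rows x = mk⇔ to from
      where
      scaled-rows : ∀ a → Sum V (λ b → (x ⊗ᵥ y) (a , b) · z (a , b)) (x a · c a)
      scaled-rows a = Sum-cong (λ b → sym (·-assoc (x a) (y b) (z (a , b)))) (Sum-scaleˡ cV (x a) (rows a))

      to : (x ⊗ᵥ y) ⊥ z → x ⊥ c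
      to (s , S , s∈𝓑) with Sum-rows cW cV S
      ... | t , rows′ , total = s , Sum-cong (λ a → Sum-unique (rows′ a) (scaled-rows a)) total , s∈𝓑

      from : x ⊥ c → (x ⊗ᵥ y) ⊥ z
      from (s , S , s∈𝓑) = s , Sum-fromRows cW cV scaled-rows S , s∈𝓑

    module _ {P : Subset W} (covP : Covering P) (P⊗y⊥z : ∀ x → P x → (x ⊗ᵥ y) ⊥ z) where

      contraction-row : ∀ a → Σ[ r ∈ Carrier ] Sum V (λ b → y b · z (a , b)) r
      contraction-row a with covP a
      ... | x , x∈P , xₐ-invertible with P⊗y⊥z x x∈P
      ... | s , S , _ with Sum-rows cW cV S
      ... | _ , rows , _ =
        Sum-cancelˡ cV xₐ-invertible (Sum-cong (λ b → ·-assoc (x a) (y b) (z (a , b))) (rows a))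

      ^⊥^⊥⊗ᵥ-⊥ : ∀ x → ((P ^⊥) ^⊥) x → (x ⊗ᵥ y) ⊥ z
      ^⊥^⊥⊗ᵥ-⊥ x x∈P^⊥⊥ = Equivalence.from (pairing x) (⊥-comm (x∈P^⊥⊥ c c∈P^⊥))
        where
        c : W → Carrier
        c = proj₁ ∘ contraction-row

        pairing : ∀ x → ((x ⊗ᵥ y) ⊥ z) ⇔ (x ⊥ c)
        pairing = ⊗ᵥ-⊥⇔⊥-contraction (proj₂ ∘ contraction-row)

        c∈P^⊥ : (P ^⊥) c
        c∈P^⊥ x′ x′∈P = Equivalence.to (pairing x′) (P⊗y⊥z x′ x′∈P)

  [⊗ₛ]^⊥⊆[^⊥^⊥⊗ₛ^⊥^⊥]^⊥ : ∀ {W V : Set} → Countable W → Countable V → {P : Subset W} {Q : Subset V} →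
                        Covering P → Covering Q → ((P ⊗ₛ Q) ^⊥) ⊆ ((((P ^⊥) ^⊥) ⊗ₛ ((Q ^⊥) ^⊥)) ^⊥)
  [⊗ₛ]^⊥⊆[^⊥^⊥⊗ₛ^⊥^⊥]^⊥ cW cV {Q = Q} covP covQ z z∈[P⊗Q]^⊥ v (x , y , x∈P^⊥⊥ , y∈Q^⊥⊥ , v≗x⊗y) =
    ⊥-congˡ (sym ∘ v≗x⊗y) (⊗ᵥ-⊥-swap cV cW (^⊥^⊥⊗ᵥ-⊥ cV cW covQ Q⊗x⊥z y y∈Q^⊥⊥))
    where
    Q⊗x⊥z : ∀ y′ → Q y′ → (y′ ⊗ᵥ x) ⊥ (z ∘ swap)
    Q⊗x⊥z y′ y′∈Q = ⊗ᵥ-⊥-swap cW cV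
      (^⊥^⊥⊗ᵥ-⊥ cW cV covP (λ x′ x′∈P → z∈[P⊗Q]^⊥ _ (x′ , y′ , x′∈P , y′∈Q , λ _ → refl)) x x∈P^⊥⊥)

corollary2p11 : (R : StrongPCR) (𝓑 : StrongPCR.Carrier R → Set) →
    Orth.DownClosed R 𝓑 →
    (X Y : Orth.RSpace R 𝓑) →
    (P : Orth.Subset R 𝓑 (Orth.Web X)) →
    (Q : Orth.Subset R 𝓑 (Orth.Web Y)) →
    Orth.Covering R 𝓑 P → Orth.Covering R 𝓑 Q →
    Orth._≐_ R 𝓑 (Orth._^⊥ R 𝓑 (Orth._^⊥ R 𝓑 P)) (Orth.P X) →
    Orth._≐_ R 𝓑 (Orth._^⊥ R 𝓑 (Orth._^⊥ R 𝓑 Q)) (Orth.P Y) →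
    Orth._≐_ R 𝓑 (Orth.P⊗ R 𝓑 X Y)
    (Orth._^⊥ R 𝓑 (Orth._^⊥ R 𝓑 (Orth._⊗ₛ_ R 𝓑 P Q)))
corollary2p11 R 𝓑 _ X Y P Q covP covQ (P^⊥^⊥⊆PX , PX⊆P^⊥^⊥) (Q^⊥^⊥⊆PY , PY⊆Q^⊥^⊥) =
  ^⊥-antitone [P⊗Q]^⊥⊆[PX⊗PY]^⊥ , ^⊥-antitone (^⊥-antitone P⊗Q⊆PX⊗PY)
  where
  open Orth R 𝓑 using (_⊆_; _^⊥; _⊗ₛ_)
  open OrthProperties R 𝓑

  [P⊗Q]^⊥⊆[PX⊗PY]^⊥ : ((P ⊗ₛ Q) ^⊥) ⊆ ((Orth.P X ⊗ₛ Orth.P Y) ^⊥)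
  [P⊗Q]^⊥⊆[PX⊗PY]^⊥ = ⊆-trans
    ([⊗ₛ]^⊥⊆[^⊥^⊥⊗ₛ^⊥^⊥]^⊥ (Orth.countable X) (Orth.countable Y) covP covQ)
    (^⊥-antitone (⊗ₛ-mono PX⊆P^⊥^⊥ PY⊆Q^⊥^⊥))

  P⊗Q⊆PX⊗PY : (P ⊗ₛ Q) ⊆ (Orth.P X ⊗ₛ Orth.P Y)
  P⊗Q⊆PX⊗PY = ⊗ₛ-mono (⊆-trans (⊆-^⊥^⊥ P) P^⊥^⊥⊆PX) (⊆-trans (⊆-^⊥^⊥ Q) Q^⊥^⊥⊆PY)
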